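{- Let $Q$ be a quadratic form on $\mathbb{F}_2^n$ with associated bilinear form $B(u,v)=Q(u+v)+Q(u)+Q(v)$, let $R=\mathrm{rad}(\mathbb{F}_2^n)=\{r:B(r,w)=0\ \forall w\}$, and suppose $R\neq0$ and $Q(r)\neq0$ for all nonzero $r\in R$. Let $V$ be a complementary subspace to $R$, so $\mathbb{F}_2^n=V\oplus R$, and let $p_R$ be the projection onto $R$ along $V$. Then for every totally singular subspace $W$ there exists a totally singular subspace $W'$ with $|W'|=|W|$ such that $W\cap W'\subseteq\langle u\rangle$ for some $u\in\mathbb{F}_2^n$ with $p_R(u)\neq0$.
   Context: A quadratic form on $\mathbb{F}_2^n$ is a map $Q(u)=\sum_{i\le j}a_{ij}u_iu_j$ with $a_{ij}\in\mathbb{F}_2$. A subspace $W$ is totally singular if $Q(w)=0$ for all $w\in W$. -}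

module Defs where

open import Data.Bool using (Bool; true; false; _xor_; _∧_; if_then_else_)
open import Data.Nat using (ℕ; zero; suc; _≤_)
open import Data.Fin using (Fin; toℕ)
open import Data.Vec using (Vec; []; _∷_; lookup; zipWith; replicate)
open import Data.List using (List; []; _∷_; _++_; map; length; filterᵇ; allFin; foldr)
open import Data.Product using (Σ; _×_; _,_; ∃)
open import Data.Sum using (_⊎_)
open import Relation.Binary.PropositionalEquality using (_≡_; _≢_)
open import Relation.Nullary.Decidable using (⌊_⌋)
open import Data.Nat.Properties using (_≤?_)

-- Vectors in F₂ⁿ: Bool = F₂, addition = xor, multiplication = ∧.
F₂^ : ℕ → Set
F₂^ n = Vec Bool n

0v : ∀ {n} → F₂^ n
0v = replicate _ false

_⊕_ : ∀ {n} → F₂^ n → F₂^ n → F₂^ n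
_⊕_ = zipWith _xor_

xsum : List Bool → Bool
xsum = foldr _xor_ false

-- Coefficient data of a quadratic form: a i j, only entries with i ≤ j are used.
Coeffs : ℕ → Set
Coeffs n = Fin n → Fin n → Bool

Q : ∀ {n} → Coeffs n → F₂^ n → Bool
Q {n} a u = xsum (Data.List.concatMap (λ i → map (λ j →
    (if ⌊ toℕ i ≤? toℕ j ⌋ then a i j else false) ∧ lookup u i ∧ lookup u j)
    (allFin n)) (allFin n))

B : ∀ {n} → Coeffs n → F₂^ n → F₂^ n → Bool
B a u v = Q a (u ⊕ v) xor Q a u xor Q a v

Rad : ∀ {n} → Coeffs n → F₂^ n → Set
Rad a r = ∀ w → B a r w ≡ false

Subset : ℕ → Set
Subset n = F₂^ n → Bool

_∈_ : ∀ {n} → F₂^ n → Subset n → Set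
x ∈ S = S x ≡ true

-- Subspace over F₂: contains 0 and closed under addition
-- (closure under scalar multiplication by 0,1 is then automatic)
IsSubspace : ∀ {n} → Subset n → Set
IsSubspace {n} S = (0v ∈ S) × (∀ (u v : F₂^ n) → u ∈ S → v ∈ S → (u ⊕ v) ∈ S)

TotallySingular : ∀ {n} → Coeffs n → Subset n → Set
TotallySingular a W = IsSubspace W × (∀ w → w ∈ W → Q a w ≡ false)

allVecs : (n : ℕ) → List (F₂^ n)
allVecs zero = [] ∷ []
allVecs (suc n) = map (false ∷_) (allVecs n) ++ map (true ∷_) (allVecs n)

card : ∀ {n} → Subset n → ℕ
card {n} S = length (filterᵇ S (allVecs n))

IsComplementToRad : ∀ {n} → Coeffs n → Subset n → Set
IsComplementToRad {n} a V =
  IsSubspace V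
  × (∀ x → x ∈ V → Rad a x → x ≡ 0v)
  × (∀ (u : F₂^ n) → Σ (F₂^ n) λ v → Σ (F₂^ n) λ r → v ∈ V × Rad a r × u ≡ v ⊕ r)

-- r = p_R(u), the projection of u onto R along V: u = v + r with v ∈ V, r ∈ R
-- (equivalently u + r ∈ V, since u = (u + r) + r)
IsProjR : ∀ {n} → Coeffs n → Subset n → F₂^ n → F₂^ n → Set
IsProjR a V u r = Rad a r × ((u ⊕ r) ∈ V)

module Submission where

-- We prove more than is asked: every totally singular W has a
-- totally singular W' with |W'| = |W| and W ∩ W' = 0.  The conclusion then
-- holds with u = r₀, any nonzero radical vector, since p_R(r₀) = r₀.
--
-- W' is built by the hyperbolic-pair induction inside a subspace A with
-- partners (every nonzero singular x ∈ A has y ∈ A with B(x,y) = 1); for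
-- A = F₂ⁿ this is exactly the anisotropy of Q on the radical.  For 0 ≠ w ∈ W
-- choose a singular v ∈ A with B(w,v) = 1.  Then W₁ = W ∩ v^⊥ has half the size
-- of W and lies in A' = A ∩ w^⊥ ∩ v^⊥, which again has partners; by induction
-- on |W|, W₁ has an opposite W₁' in A', and W₁' + ⟨v⟩ is an opposite of W.

open import Defs
open import Level using (0ℓ)
open import Data.Bool using (Bool; true; false; _xor_; _∧_; _∨_; not; if_then_else_)
open import Data.Bool.Properties
  using (xor-comm; xor-assoc; xor-same; xor-identityʳ; ∧-zeroʳ; not-distribʳ-xor; ¬-not; ∨-zeroʳ; xor-∧-commutativeRing)
  renaming (_≟_ to _≟ᵇ_)
open import Data.Nat using (ℕ; suc; _+_; _≤_; _<_; s≤s; z≤n)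
open import Data.Nat.Properties using (+-comm; +-suc; m<m+n; _≤?_)
open import Data.Nat.Induction using (<-rec)
open import Data.Fin using (Fin; toℕ)
open import Data.Maybe using (just; nothing)
open import Data.Vec using ([]; _∷_; lookup)
open import Data.Vec.Properties using (lookup-zipWith; zipWith-comm; zipWith-assoc; zipWith-identityʳ)
  renaming (≡-dec to ≡-decᵛ)
open import Data.List using (List; []; _∷_; _++_; map; length; filterᵇ; allFin; concatMap)
open import Data.List.Properties using (map-cong; map-∘; concatMap-cong; map-concatMap)
open import Data.List.Membership.Propositional using (lose) renaming (_∈_ to _∈ˡ_)
open import Data.List.Membership.Propositional.Properties using (∈-++⁺ˡ; ∈-++⁺ʳ; ∈-map⁺)
open import Data.List.Relation.Unary.Any using (here; there; any?; satisfied)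
open import Data.Product using (Σ; ∃; _×_; _,_; proj₁; proj₂)
open import Data.Sum using (_⊎_; inj₁; inj₂)
open import Data.Empty using (⊥-elim)
open import Relation.Nullary using (¬_; Dec; yes; no)
open import Relation.Nullary.Decidable using (⌊_⌋; _×-dec_; ¬?)
open import Relation.Unary using (Decidable)
open import Relation.Binary.PropositionalEquality using (_≡_; _≢_; refl; sym; trans; cong; cong₂; subst; module ≡-Reasoning)
open import Tactic.RingSolver using (solve-∀)
open import Tactic.RingSolver.Core.AlmostCommutativeRing using (AlmostCommutativeRing; fromCommutativeRing)

open ≡-Reasoning

-- Booleans under xor and ∧ form the field F₂; as a commutative ring this
-- lets the ring solver discharge polynomial identities between bits.
F₂ : AlmostCommutativeRing 0ℓ 0ℓ
F₂ = fromCommutativeRing xor-∧-commutativeRing λ { false → just refl ; true → nothing }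

xor-cancelʳ : ∀ x y → (x xor y) xor y ≡ x
xor-cancelʳ x y = begin
  (x xor y) xor y  ≡⟨ xor-assoc x y y ⟩
  x xor (y xor y)  ≡⟨ cong (x xor_) (xor-same y) ⟩
  x xor false      ≡⟨ xor-identityʳ x ⟩
  x                ∎

true≢false : true ≢ false
true≢false ()

xor-interchange : ∀ p q r s → (p xor q) xor (r xor s) ≡ (p xor r) xor (q xor s)
xor-interchange = solve-∀ F₂

⊕-comm : ∀ {n} (x y : F₂^ n) → x ⊕ y ≡ y ⊕ x
⊕-comm = zipWith-comm xor-comm

⊕-assoc : ∀ {n} (x y z : F₂^ n) → (x ⊕ y) ⊕ z ≡ x ⊕ (y ⊕ z)
⊕-assoc = zipWith-assoc xor-assoc

⊕-identityʳ : ∀ {n} (x : F₂^ n) → x ⊕ 0v ≡ x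
⊕-identityʳ = zipWith-identityʳ xor-identityʳ

⊕-self : ∀ {n} (x : F₂^ n) → x ⊕ x ≡ 0v
⊕-self []      = refl
⊕-self (b ∷ x) = cong₂ _∷_ (xor-same b) (⊕-self x)

⊕-cancelʳ : ∀ {n} (x v : F₂^ n) → (x ⊕ v) ⊕ v ≡ x
⊕-cancelʳ x v = begin
  (x ⊕ v) ⊕ v  ≡⟨ ⊕-assoc x v v ⟩
  x ⊕ (v ⊕ v)  ≡⟨ cong (x ⊕_) (⊕-self v) ⟩
  x ⊕ 0v       ≡⟨ ⊕-identityʳ x ⟩
  x            ∎

⊕-swap : ∀ {n} (x y v : F₂^ n) → (x ⊕ v) ⊕ y ≡ (x ⊕ y) ⊕ v
⊕-swap x y v = begin
  (x ⊕ v) ⊕ y  ≡⟨ ⊕-assoc x v y ⟩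
  x ⊕ (v ⊕ y)  ≡⟨ cong (x ⊕_) (⊕-comm v y) ⟩
  x ⊕ (y ⊕ v)  ≡⟨ ⊕-assoc x y v ⟨
  (x ⊕ y) ⊕ v  ∎

⊕-both : ∀ {n} (x y v : F₂^ n) → (x ⊕ v) ⊕ (y ⊕ v) ≡ x ⊕ y
⊕-both x y v = begin
  (x ⊕ v) ⊕ (y ⊕ v)  ≡⟨ ⊕-assoc (x ⊕ v) y v ⟨
  ((x ⊕ v) ⊕ y) ⊕ v  ≡⟨ cong (_⊕ v) (⊕-swap x y v) ⟩
  ((x ⊕ y) ⊕ v) ⊕ v  ≡⟨ ⊕-cancelʳ (x ⊕ y) v ⟩
  x ⊕ y              ∎

sumOver : ∀ {X : Set} → List X → (X → Bool) → Bool
sumOver xs f = xsum (map f xs)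

sumOver-cong : ∀ {X : Set} (xs : List X) {f g : X → Bool} → (∀ x → f x ≡ g x) → sumOver xs f ≡ sumOver xs g
sumOver-cong xs f≗g = cong xsum (map-cong f≗g xs)

sumOver-xor : ∀ {X : Set} (xs : List X) (f g : X → Bool) →
  sumOver xs (λ x → f x xor g x) ≡ sumOver xs f xor sumOver xs g
sumOver-xor []       f g = refl
sumOver-xor (x ∷ xs) f g = begin
  (f x xor g x) xor sumOver xs (λ y → f y xor g y)  ≡⟨ cong ((f x xor g x) xor_) (sumOver-xor xs f g) ⟩
  (f x xor g x) xor (sumOver xs f xor sumOver xs g) ≡⟨ xor-interchange (f x) (g x) _ _ ⟩
  sumOver (x ∷ xs) f xor sumOver (x ∷ xs) g         ∎

sumOver-zero : ∀ {X : Set} (xs : List X) → sumOver xs (λ _ → false) ≡ false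
sumOver-zero []       = refl
sumOver-zero (_ ∷ xs) = sumOver-zero xs

-- Polarization: Q(u + v) = Q(u) + Q(v) + β(u,v) for an explicit bilinear β,
-- so B = β is a symmetric, alternating bilinear form.
module Polarization {n : ℕ} (a : Coeffs n) where

  coef : Fin n → Fin n → Bool
  coef i j = if ⌊ toℕ i ≤? toℕ j ⌋ then a i j else false

  pairs : List (Fin n × Fin n)
  pairs = concatMap (λ i → map (i ,_) (allFin n)) (allFin n)

  square : F₂^ n → Fin n × Fin n → Bool
  square u (i , j) = coef i j ∧ lookup u i ∧ lookup u j

  mixed : F₂^ n → F₂^ n → Fin n × Fin n → Bool
  mixed u v (i , j) = coef i j ∧ (lookup u i ∧ lookup v j xor lookup v i ∧ lookup u j)

  polar : F₂^ n → F₂^ n → Bool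
  polar u v = sumOver pairs (mixed u v)

  Q-as-sum : ∀ u → Q a u ≡ sumOver pairs (square u)
  Q-as-sum u = cong xsum (sym (begin
    map (square u) pairs
      ≡⟨ map-concatMap (square u) (λ i → map (i ,_) (allFin n)) (allFin n) ⟩
    concatMap (λ i → map (square u) (map (i ,_) (allFin n))) (allFin n)
      ≡⟨ concatMap-cong (λ i → sym (map-∘ (allFin n))) (allFin n) ⟩
    concatMap (λ i → map (λ j → square u (i , j)) (allFin n)) (allFin n) ∎))

  -- Expanding each monomial (uᵢ + vᵢ)(uⱼ + vⱼ) gives the polarization identity.
  Q-polarization : ∀ u v → Q a (u ⊕ v) ≡ polar u v xor (Q a u xor Q a v)
  Q-polarization u v = begin
    Q a (u ⊕ v)                                              ≡⟨ Q-as-sum (u ⊕ v) ⟩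
    sumOver pairs (square (u ⊕ v))                           ≡⟨ sumOver-cong pairs expand ⟩
    sumOver pairs (λ ij → mixed u v ij xor (square u ij xor square v ij))
                                                             ≡⟨ sumOver-xor pairs (mixed u v) _ ⟩
    polar u v xor sumOver pairs (λ ij → square u ij xor square v ij)
                                                             ≡⟨ cong (polar u v xor_) (sumOver-xor pairs (square u) (square v)) ⟩
    polar u v xor (sumOver pairs (square u) xor sumOver pairs (square v))
                                                             ≡⟨ cong (polar u v xor_) (cong₂ _xor_ (Q-as-sum u) (Q-as-sum v)) ⟨
    polar u v xor (Q a u xor Q a v)                          ∎
    where
    polarize : ∀ c p q r s → c ∧ (p xor r) ∧ (q xor s) ≡ (c ∧ (p ∧ s xor r ∧ q)) xor ((c ∧ p ∧ q) xor (c ∧ r ∧ s))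
    polarize = solve-∀ F₂
    expand : ∀ ij → square (u ⊕ v) ij ≡ mixed u v ij xor (square u ij xor square v ij)
    expand (i , j) = begin
      coef i j ∧ lookup (u ⊕ v) i ∧ lookup (u ⊕ v) j
        ≡⟨ cong₂ (λ p q → coef i j ∧ p ∧ q) (lookup-zipWith _xor_ i u v) (lookup-zipWith _xor_ j u v) ⟩
      coef i j ∧ (lookup u i xor lookup v i) ∧ (lookup u j xor lookup v j)
        ≡⟨ polarize (coef i j) (lookup u i) (lookup u j) (lookup v i) (lookup v j) ⟩
      mixed u v (i , j) xor (square u (i , j) xor square v (i , j)) ∎

  B≡polar : ∀ u v → B a u v ≡ polar u v
  B≡polar u v = trans (cong (_xor (Q a u xor Q a v)) (Q-polarization u v)) (xor-cancelʳ (polar u v) _)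

  Q-add : ∀ u v → Q a (u ⊕ v) ≡ B a u v xor (Q a u xor Q a v)
  Q-add u v = trans (Q-polarization u v) (cong (_xor (Q a u xor Q a v)) (sym (B≡polar u v)))

  B-sym : ∀ u v → B a u v ≡ B a v u
  B-sym u v = begin
    B a u v    ≡⟨ B≡polar u v ⟩
    polar u v  ≡⟨ sumOver-cong pairs (λ { (i , j) → cong (coef i j ∧_) (xor-comm (lookup u i ∧ lookup v j) (lookup v i ∧ lookup u j)) }) ⟩
    polar v u  ≡⟨ B≡polar v u ⟨
    B a v u    ∎

  B-linʳ : ∀ x y z → B a x (y ⊕ z) ≡ B a x y xor B a x z
  B-linʳ x y z = begin
    B a x (y ⊕ z)                    ≡⟨ B≡polar x (y ⊕ z) ⟩
    polar x (y ⊕ z)                  ≡⟨ sumOver-cong pairs expand ⟩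
    sumOver pairs (λ ij → mixed x y ij xor mixed x z ij)
                                     ≡⟨ sumOver-xor pairs (mixed x y) (mixed x z) ⟩
    polar x y xor polar x z          ≡⟨ cong₂ _xor_ (B≡polar x y) (B≡polar x z) ⟨
    B a x y xor B a x z              ∎
    where
    distribute : ∀ c p q r s t u → c ∧ (p ∧ (r xor t) xor (s xor u) ∧ q) ≡ (c ∧ (p ∧ r xor s ∧ q)) xor (c ∧ (p ∧ t xor u ∧ q))
    distribute = solve-∀ F₂
    expand : ∀ ij → mixed x (y ⊕ z) ij ≡ mixed x y ij xor mixed x z ij
    expand (i , j) = begin
      coef i j ∧ (lookup x i ∧ lookup (y ⊕ z) j xor lookup (y ⊕ z) i ∧ lookup x j)
        ≡⟨ cong₂ (λ p q → coef i j ∧ (lookup x i ∧ p xor q ∧ lookup x j))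
                 (lookup-zipWith _xor_ j y z) (lookup-zipWith _xor_ i y z) ⟩
      coef i j ∧ (lookup x i ∧ (lookup y j xor lookup z j) xor (lookup y i xor lookup z i) ∧ lookup x j)
        ≡⟨ distribute (coef i j) (lookup x i) (lookup x j) (lookup y j) (lookup y i) (lookup z j) (lookup z i) ⟩
      mixed x y (i , j) xor mixed x z (i , j) ∎

  B-linˡ : ∀ x y z → B a (x ⊕ y) z ≡ B a x z xor B a y z
  B-linˡ x y z = begin
    B a (x ⊕ y) z        ≡⟨ B-sym (x ⊕ y) z ⟩
    B a z (x ⊕ y)        ≡⟨ B-linʳ z x y ⟩
    B a z x xor B a z y  ≡⟨ cong₂ _xor_ (B-sym z x) (B-sym z y) ⟩
    B a x z xor B a y z  ∎

  B-self : ∀ x → B a x x ≡ false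
  B-self x = begin
    B a x x    ≡⟨ B≡polar x x ⟩
    polar x x  ≡⟨ sumOver-cong pairs (λ { (i , j) → trans (cong (coef i j ∧_) (xor-same (lookup x i ∧ lookup x j))) (∧-zeroʳ (coef i j)) }) ⟩
    sumOver pairs (λ _ → false) ≡⟨ sumOver-zero pairs ⟩
    false      ∎

  B-0ʳ : ∀ x → B a x 0v ≡ false
  B-0ʳ x = begin
    B a x 0v                   ≡⟨ cong (B a x) (⊕-self 0v) ⟨
    B a x (0v ⊕ 0v)            ≡⟨ B-linʳ x 0v 0v ⟩
    B a x 0v xor B a x 0v      ≡⟨ xor-same (B a x 0v) ⟩
    false                      ∎

count : ∀ {n} → Subset n → List (F₂^ n) → ℕ
count S xs = length (filterᵇ S xs)

count-ext : ∀ {n} {S T : Subset n} → (∀ x → S x ≡ T x) → ∀ xs → count S xs ≡ count T xs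
count-ext S≗T [] = refl
count-ext {S = S} {T} S≗T (x ∷ xs) with S x | T x | S≗T x
... | true  | .true  | refl = cong suc (count-ext S≗T xs)
... | false | .false | refl = count-ext S≗T xs

card-ext : ∀ {n} (S T : Subset n) → (∀ x → S x ≡ T x) → card S ≡ card T
card-ext {n} S T S≗T = count-ext S≗T (allVecs n)

count-split : ∀ {n} (S P : Subset n) xs →
  count S xs ≡ count (λ x → S x ∧ P x) xs + count (λ x → S x ∧ not (P x)) xs
count-split S P [] = refl
count-split S P (x ∷ xs) with S x | P x
... | true  | true  = cong suc (count-split S P xs)
... | true  | false = trans (cong suc (count-split S P xs)) (sym (+-suc _ _))
... | false | _     = count-split S P xs

count-++ : ∀ {n} (S : Subset n) xs ys → count S (xs ++ ys) ≡ count S xs + count S ys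
count-++ S []       ys = refl
count-++ S (x ∷ xs) ys with S x
... | true  = cong suc (count-++ S xs ys)
... | false = count-++ S xs ys

count-map : ∀ {m n} (S : Subset n) (f : F₂^ m → F₂^ n) xs → count S (map f xs) ≡ count (λ x → S (f x)) xs
count-map S f []       = refl
count-map S f (x ∷ xs) with S (f x)
... | true  = cong suc (count-map S f xs)
... | false = count-map S f xs

card-cons : ∀ {n} (S : Subset (suc n)) → card S ≡ card (λ x → S (false ∷ x)) + card (λ x → S (true ∷ x))
card-cons {n} S = trans (count-++ S (map (false ∷_) (allVecs n)) (map (true ∷_) (allVecs n)))
                        (cong₂ _+_ (count-map S (false ∷_) (allVecs n)) (count-map S (true ∷_) (allVecs n)))

card-translate : ∀ {n} (S : Subset n) (c : F₂^ n) → card (λ x → S (x ⊕ c)) ≡ card S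
card-translate S [] = card-ext (λ x → S (x ⊕ [])) S λ { [] → refl }
card-translate S (false ∷ c) = begin
  card (λ x → S (x ⊕ (false ∷ c)))
    ≡⟨ card-cons (λ x → S (x ⊕ (false ∷ c))) ⟩
  card (λ x → S (false ∷ (x ⊕ c))) + card (λ x → S (true ∷ (x ⊕ c)))
    ≡⟨ cong₂ _+_ (card-translate (λ x → S (false ∷ x)) c) (card-translate (λ x → S (true ∷ x)) c) ⟩
  card (λ x → S (false ∷ x)) + card (λ x → S (true ∷ x))
    ≡⟨ card-cons S ⟨
  card S ∎
card-translate S (true ∷ c) = begin
  card (λ x → S (x ⊕ (true ∷ c)))
    ≡⟨ card-cons (λ x → S (x ⊕ (true ∷ c))) ⟩
  card (λ x → S (true ∷ (x ⊕ c))) + card (λ x → S (false ∷ (x ⊕ c)))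
    ≡⟨ cong₂ _+_ (card-translate (λ x → S (true ∷ x)) c) (card-translate (λ x → S (false ∷ x)) c) ⟩
  card (λ x → S (true ∷ x)) + card (λ x → S (false ∷ x))
    ≡⟨ +-comm (card (λ x → S (true ∷ x))) _ ⟩
  card (λ x → S (false ∷ x)) + card (λ x → S (true ∷ x))
    ≡⟨ card-cons S ⟨
  card S ∎

allVecs-complete : ∀ {n} (x : F₂^ n) → x ∈ˡ allVecs n
allVecs-complete []                = here refl
allVecs-complete (false ∷ x)       = ∈-++⁺ˡ (∈-map⁺ (false ∷_) (allVecs-complete x))
allVecs-complete {suc n} (true ∷ x) =
  ∈-++⁺ʳ (map (false ∷_) (allVecs n)) (∈-map⁺ (true ∷_) (allVecs-complete x))

card-pos : ∀ {n} (S : Subset n) x → x ∈ S → 1 ≤ card S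
card-pos {n} S x x∈S = count-pos (allVecs n) (allVecs-complete x)
  where
  count-pos : ∀ xs → x ∈ˡ xs → 1 ≤ count S xs
  count-pos (y ∷ xs) x∈xs with S y in Sy
  ... | true = s≤s z≤n
  count-pos (y ∷ xs) (here refl) | false = ⊥-elim (true≢false (trans (sym x∈S) Sy))
  count-pos (y ∷ xs) (there x∈xs) | false = count-pos xs x∈xs

search : ∀ {n} {P : F₂^ n → Set} → Decidable P → ∃ P ⊎ (∀ x → ¬ P x)
search {n} P? with any? P? (allVecs n)
... | yes found = inj₁ (satisfied found)
... | no  none  = inj₂ λ x Px → none (lose (allVecs-complete x) Px)

Linear : ∀ {n} → (F₂^ n → Bool) → Set
Linear {n} φ = ∀ (x y : F₂^ n) → φ (x ⊕ y) ≡ φ x xor φ y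

linear-0 : ∀ {n} (φ : F₂^ n → Bool) → Linear φ → φ 0v ≡ false
linear-0 φ lin = begin
  φ 0v             ≡⟨ cong φ (⊕-self 0v) ⟨
  φ (0v ⊕ 0v)      ≡⟨ lin 0v 0v ⟩
  φ 0v xor φ 0v    ≡⟨ xor-same (φ 0v) ⟩
  false            ∎

_∩ker_ : ∀ {n} → Subset n → (F₂^ n → Bool) → Subset n
(S ∩ker φ) x = S x ∧ not (φ x)

∩ker-intro : ∀ {n} (S : Subset n) φ {x} → x ∈ S → φ x ≡ false → x ∈ (S ∩ker φ)
∩ker-intro S φ x∈S φx≡0 = cong₂ (λ s f → s ∧ not f) x∈S φx≡0

∩ker-elim : ∀ {n} (S : Subset n) φ {x} → x ∈ (S ∩ker φ) → x ∈ S × φ x ≡ false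
∩ker-elim S φ {x} x∈K with S x | φ x | x∈K
... | true  | false | _ = refl , refl

∩ker-subspace : ∀ {n} (S : Subset n) φ → IsSubspace S → Linear φ → IsSubspace (S ∩ker φ)
∩ker-subspace S φ (0∈S , closed) lin = ∩ker-intro S φ 0∈S (linear-0 φ lin) , closed′
  where
  closed′ : ∀ x y → x ∈ (S ∩ker φ) → y ∈ (S ∩ker φ) → (x ⊕ y) ∈ (S ∩ker φ)
  closed′ x y x∈K y∈K with ∩ker-elim S φ x∈K | ∩ker-elim S φ y∈K
  ... | x∈S , φx | y∈S , φy = ∩ker-intro S φ (closed x y x∈S y∈S) (trans (lin x y) (cong₂ _xor_ φx φy))

translate-invariant : ∀ {n} {S : Subset n} → IsSubspace S → ∀ {s} → s ∈ S → ∀ x → S (x ⊕ s) ≡ S x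
translate-invariant {S = S} (_ , closed) {s} s∈S x with S x in Sx | S (x ⊕ s) in Sxs
... | true  | true  = refl
... | false | false = refl
... | true  | false = trans (sym Sxs) (closed x s Sx s∈S)
... | false | true  = trans (sym (trans (cong S (sym (⊕-cancelʳ x s))) (closed (x ⊕ s) s Sxs s∈S))) Sx

-- Halving: if a linear functional φ is nonzero on the subspace S, then its
-- kernel in S has exactly half the elements of S (the other half is a coset).
card-halving : ∀ {n} (S : Subset n) φ → IsSubspace S → Linear φ → ∀ {s} → s ∈ S → φ s ≡ true →
  card S ≡ card (S ∩ker φ) + card (S ∩ker φ)
card-halving {n} S φ subS lin {s} s∈S φs = begin
  card S
    ≡⟨ count-split S φ (allVecs n) ⟩
  card (λ x → S x ∧ φ x) + card (S ∩ker φ)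
    ≡⟨ cong (_+ card (S ∩ker φ)) (card-ext (λ x → S x ∧ φ x) (λ x → (S ∩ker φ) (x ⊕ s)) coset) ⟩
  card (λ x → (S ∩ker φ) (x ⊕ s)) + card (S ∩ker φ)
    ≡⟨ cong (_+ card (S ∩ker φ)) (card-translate (S ∩ker φ) s) ⟩
  card (S ∩ker φ) + card (S ∩ker φ) ∎
  where
  coset : ∀ x → S x ∧ φ x ≡ S (x ⊕ s) ∧ not (φ (x ⊕ s))
  coset x = sym (cong₂ _∧_ (translate-invariant subS s∈S x) (begin
    not (φ (x ⊕ s))     ≡⟨ cong not (trans (lin x s) (cong (φ x xor_) φs)) ⟩
    not (φ x xor true)  ≡⟨ not-distribʳ-xor (φ x) true ⟩
    φ x xor false       ≡⟨ xor-identityʳ (φ x) ⟩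
    φ x                 ∎))

module Opposite {n : ℕ} (a : Coeffs n) where
  open Polarization a using (Q-add; B-sym; B-linˡ; B-linʳ; B-self; B-0ʳ)

  _⊆_ : Subset n → Subset n → Set
  S ⊆ T = ∀ x → x ∈ S → x ∈ T

  _⟂_ : Subset n → F₂^ n → Set
  S ⟂ v = ∀ x → x ∈ S → B a x v ≡ false

  B· : F₂^ n → F₂^ n → Bool
  B· v x = B a x v

  B·-linear : ∀ v → Linear (B· v)
  B·-linear v x y = B-linˡ x y v

  _∩⊥_ : Subset n → F₂^ n → Subset n
  S ∩⊥ v = S ∩ker B· v

  HasPartners : Subset n → Set
  HasPartners A = ∀ x → x ∈ A → x ≢ 0v → Q a x ≡ false → ∃ λ y → y ∈ A × B a x y ≡ true

  OppositeIn : Subset n → Subset n → Subset n → Set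
  OppositeIn A W W' = TotallySingular a W' × W' ⊆ A × card W' ≡ card W × (∀ x → x ∈ W → x ∈ W' → x ≡ 0v)

  singular-orthogonal : ∀ {W} → TotallySingular a W → ∀ {x y} → x ∈ W → y ∈ W → B a x y ≡ false
  singular-orthogonal ((_ , closed) , singular) {x} {y} x∈W y∈W =
    cong₂ _xor_ (singular (x ⊕ y) (closed x y x∈W y∈W)) (cong₂ _xor_ (singular x x∈W) (singular y y∈W))

  -- A nonzero singular w ∈ A has a singular partner v ∈ A with B(w,v) = 1:
  -- if a partner y is not singular, then y + w is.
  singular-partner : ∀ {A} → IsSubspace A → HasPartners A → ∀ {w} → w ∈ A → w ≢ 0v → Q a w ≡ false →
    ∃ λ v → v ∈ A × Q a v ≡ false × B a w v ≡ true
  singular-partner {A} (_ , closed) partners {w} w∈A w≢0 Qw with partners w w∈A w≢0 Qw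
  ... | y , y∈A , Bwy = by-singularity (Q a y) refl
    where
    Q-y⊕w : Q a y ≡ true → Q a (y ⊕ w) ≡ false
    Q-y⊕w Qy = begin
      Q a (y ⊕ w)                    ≡⟨ Q-add y w ⟩
      B a y w xor (Q a y xor Q a w)  ≡⟨ cong₂ (λ b q → b xor (q xor Q a w)) (trans (B-sym y w) Bwy) Qy ⟩
      true xor (true xor Q a w)      ≡⟨ cong (λ q → true xor (true xor q)) Qw ⟩
      false                          ∎
    B-w-y⊕w : B a w (y ⊕ w) ≡ true
    B-w-y⊕w = begin
      B a w (y ⊕ w)        ≡⟨ B-linʳ w y w ⟩
      B a w y xor B a w w  ≡⟨ cong₂ _xor_ Bwy (B-self w) ⟩
      true                 ∎
    by-singularity : ∀ q → Q a y ≡ q → ∃ λ v → v ∈ A × Q a v ≡ false × B a w v ≡ true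
    by-singularity false Qy = y , y∈A , Qy , Bwy
    by-singularity true  Qy = y ⊕ w , closed y w y∈A w∈A , Q-y⊕w Qy , B-w-y⊕w

  scale : Bool → F₂^ n → F₂^ n
  scale b x = if b then x else 0v

  B-scale : ∀ z b x → B a z (scale b x) ≡ b ∧ B a z x
  B-scale z true  x = refl
  B-scale z false x = B-0ʳ z

  scale-in : ∀ {S} → IsSubspace S → ∀ b {x} → x ∈ S → scale b x ∈ S
  scale-in _         true  x∈S = x∈S
  scale-in (0∈S , _) false _   = 0∈S

  -- For a hyperbolic pair (w, v) in A, the subspace A ∩ w^⊥ ∩ v^⊥ again has
  -- partners: a partner y of x in A is corrected to y + B(y,v)·w + B(y,w)·v,
  -- which is orthogonal to w and v and still pairs with x.
  perp-has-partners : ∀ {A} → IsSubspace A → HasPartners A → ∀ {w v} → w ∈ A → v ∈ A → B a w v ≡ true →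
    HasPartners ((A ∩⊥ w) ∩⊥ v)
  perp-has-partners {A} subA@(_ , closed) partners {w} {v} w∈A v∈A Bwv x x∈A′ x≢0 Qx
    with ∩ker-elim (A ∩⊥ w) (B· v) x∈A′
  ... | x∈A∩⊥w , Bxv with ∩ker-elim A (B· w) x∈A∩⊥w
  ... | x∈A , Bxw with partners x x∈A x≢0 Qx
  ... | y , y∈A , Bxy =
    y′ , ∩ker-intro (A ∩⊥ w) (B· v) (∩ker-intro A (B· w) y′∈A B-y′w) B-y′v , B-xy′
    where
    b₁ = B a y v
    b₂ = B a y w
    y′ = (y ⊕ scale b₁ w) ⊕ scale b₂ v

    y′∈A : y′ ∈ A
    y′∈A = closed _ _ (closed _ _ y∈A (scale-in subA b₁ w∈A)) (scale-in subA b₂ v∈A)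

    B-y′ : ∀ z → B a z y′ ≡ (B a z y xor (b₁ ∧ B a z w)) xor (b₂ ∧ B a z v)
    B-y′ z = begin
      B a z y′                                             ≡⟨ B-linʳ z _ _ ⟩
      B a z (y ⊕ scale b₁ w) xor B a z (scale b₂ v)        ≡⟨ cong₂ _xor_ (B-linʳ z y _) (B-scale z b₂ v) ⟩
      (B a z y xor B a z (scale b₁ w)) xor (b₂ ∧ B a z v)  ≡⟨ cong (λ t → (B a z y xor t) xor (b₂ ∧ B a z v)) (B-scale z b₁ w) ⟩
      (B a z y xor (b₁ ∧ B a z w)) xor (b₂ ∧ B a z v)      ∎

    cancel-w : ∀ p q → (q xor (p ∧ false)) xor (q ∧ true) ≡ false
    cancel-w false false = refl
    cancel-w false true  = refl
    cancel-w true  false = refl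
    cancel-w true  true  = refl

    cancel-v : ∀ p q → (p xor (p ∧ true)) xor (q ∧ false) ≡ false
    cancel-v false false = refl
    cancel-v false true  = refl
    cancel-v true  false = refl
    cancel-v true  true  = refl

    keep-x : ∀ p q → (true xor (p ∧ false)) xor (q ∧ false) ≡ true
    keep-x false false = refl
    keep-x false true  = refl
    keep-x true  false = refl
    keep-x true  true  = refl

    B-y′w : B a y′ w ≡ false
    B-y′w = begin
      B a y′ w                                            ≡⟨ B-sym y′ w ⟩
      B a w y′                                            ≡⟨ B-y′ w ⟩
      (B a w y xor (b₁ ∧ B a w w)) xor (b₂ ∧ B a w v)     ≡⟨ cong₂ (λ p q → (p xor (b₁ ∧ q)) xor (b₂ ∧ B a w v)) (B-sym w y) (B-self w) ⟩
      (b₂ xor (b₁ ∧ false)) xor (b₂ ∧ B a w v)            ≡⟨ cong (λ q → (b₂ xor (b₁ ∧ false)) xor (b₂ ∧ q)) Bwv ⟩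
      (b₂ xor (b₁ ∧ false)) xor (b₂ ∧ true)               ≡⟨ cancel-w b₁ b₂ ⟩
      false                                               ∎

    B-y′v : B a y′ v ≡ false
    B-y′v = begin
      B a y′ v                                            ≡⟨ B-sym y′ v ⟩
      B a v y′                                            ≡⟨ B-y′ v ⟩
      (B a v y xor (b₁ ∧ B a v w)) xor (b₂ ∧ B a v v)     ≡⟨ cong₂ (λ p q → (p xor (b₁ ∧ q)) xor (b₂ ∧ B a v v)) (B-sym v y) (trans (B-sym v w) Bwv) ⟩
      (b₁ xor (b₁ ∧ true)) xor (b₂ ∧ B a v v)             ≡⟨ cong (λ q → (b₁ xor (b₁ ∧ true)) xor (b₂ ∧ q)) (B-self v) ⟩
      (b₁ xor (b₁ ∧ true)) xor (b₂ ∧ false)               ≡⟨ cancel-v b₁ b₂ ⟩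
      false                                               ∎

    B-xy′ : B a x y′ ≡ true
    B-xy′ = begin
      B a x y′                                            ≡⟨ B-y′ x ⟩
      (B a x y xor (b₁ ∧ B a x w)) xor (b₂ ∧ B a x v)     ≡⟨ cong₂ (λ p q → (p xor (b₁ ∧ q)) xor (b₂ ∧ B a x v)) Bxy Bxw ⟩
      (true xor (b₁ ∧ false)) xor (b₂ ∧ B a x v)          ≡⟨ cong (λ q → (true xor (b₁ ∧ false)) xor (b₂ ∧ q)) Bxv ⟩
      (true xor (b₁ ∧ false)) xor (b₂ ∧ false)            ≡⟨ keep-x b₁ b₂ ⟩
      true                                                ∎

  _+⟨_⟩ : Subset n → F₂^ n → Subset n
  (S +⟨ v ⟩) x = S x ∨ S (x ⊕ v)

  span-inl : ∀ S v {x} → x ∈ S → x ∈ (S +⟨ v ⟩)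
  span-inl S v {x} x∈S = cong (_∨ S (x ⊕ v)) x∈S

  span-inr : ∀ S v {x} → (x ⊕ v) ∈ S → x ∈ (S +⟨ v ⟩)
  span-inr S v {x} x⊕v∈S = trans (cong (S x ∨_) x⊕v∈S) (∨-zeroʳ (S x))

  span-cases : ∀ S v {x} → x ∈ (S +⟨ v ⟩) → x ∈ S ⊎ (x ⊕ v) ∈ S
  span-cases S v {x} x∈span with S x
  ... | true  = inj₁ refl
  ... | false = inj₂ x∈span

  span-subspace : ∀ {S} → IsSubspace S → ∀ v → IsSubspace (S +⟨ v ⟩)
  span-subspace {S} (0∈S , closed) v = span-inl S v 0∈S , closed′
    where
    closed′ : ∀ x y → x ∈ (S +⟨ v ⟩) → y ∈ (S +⟨ v ⟩) → (x ⊕ y) ∈ (S +⟨ v ⟩)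
    closed′ x y x∈ y∈ with span-cases S v x∈ | span-cases S v y∈
    ... | inj₁ x∈S | inj₁ y∈S = span-inl S v (closed x y x∈S y∈S)
    ... | inj₁ x∈S | inj₂ y+v∈S =
      span-inr S v (subst (_∈ S) (sym (⊕-assoc x y v)) (closed x (y ⊕ v) x∈S y+v∈S))
    ... | inj₂ x+v∈S | inj₁ y∈S =
      span-inr S v (subst (_∈ S) (⊕-swap x y v) (closed (x ⊕ v) y x+v∈S y∈S))
    ... | inj₂ x+v∈S | inj₂ y+v∈S =
      span-inl S v (subst (_∈ S) (⊕-both x y v) (closed (x ⊕ v) (y ⊕ v) x+v∈S y+v∈S))

  span-⊆ : ∀ {A S v} → IsSubspace A → S ⊆ A → v ∈ A → (S +⟨ v ⟩) ⊆ A
  span-⊆ {A} {S} {v} (_ , closed) S⊆A v∈A x x∈span with span-cases S v x∈span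
  ... | inj₁ x∈S   = S⊆A x x∈S
  ... | inj₂ x+v∈S = subst (_∈ A) (⊕-cancelʳ x v) (closed (x ⊕ v) v (S⊆A (x ⊕ v) x+v∈S) v∈A)

  -- Adding a singular vector orthogonal to a totally singular S keeps it
  -- totally singular: Q(s + v) = B(s,v) + Q(s) + Q(v) = 0.
  span-singular : ∀ {S v} → TotallySingular a S → Q a v ≡ false → S ⟂ v → TotallySingular a (S +⟨ v ⟩)
  span-singular {S} {v} (subS , singS) Qv S⟂v = span-subspace subS v , singular
    where
    singular : ∀ x → x ∈ (S +⟨ v ⟩) → Q a x ≡ false
    singular x x∈span with span-cases S v x∈span
    ... | inj₁ x∈S   = singS x x∈S
    ... | inj₂ x+v∈S = begin
      Q a x                                        ≡⟨ cong (Q a) (⊕-cancelʳ x v) ⟨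
      Q a ((x ⊕ v) ⊕ v)                            ≡⟨ Q-add (x ⊕ v) v ⟩
      B a (x ⊕ v) v xor (Q a (x ⊕ v) xor Q a v)    ≡⟨ cong₂ (λ b q → b xor (q xor Q a v)) (S⟂v _ x+v∈S) (singS _ x+v∈S) ⟩
      false xor (false xor Q a v)                  ≡⟨ cong (λ q → false xor (false xor q)) Qv ⟩
      false                                        ∎

  coset-pairs : ∀ {S v w} → S ⟂ w → B a v w ≡ true → ∀ x → (x ⊕ v) ∈ S → B a x w ≡ true
  coset-pairs {S} {v} {w} S⟂w Bvw x x+v∈S = begin
    B a x w                          ≡⟨ cong (B· w) (⊕-cancelʳ x v) ⟨
    B a ((x ⊕ v) ⊕ v) w              ≡⟨ B-linˡ (x ⊕ v) v w ⟩
    B a (x ⊕ v) w xor B a v w        ≡⟨ cong₂ _xor_ (S⟂w _ x+v∈S) Bvw ⟩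
    true                             ∎

  -- Under the same hypotheses the span is exactly twice as large as S,
  -- since S is the kernel of B(·,w) in it.
  span-card : ∀ {S v w} → IsSubspace S → S ⟂ w → B a v w ≡ true → card (S +⟨ v ⟩) ≡ card S + card S
  span-card {S} {v} {w} subS S⟂w Bvw = begin
    card (S +⟨ v ⟩)
      ≡⟨ card-halving (S +⟨ v ⟩) (B· w) (span-subspace subS v) (B·-linear w) v∈span Bvw ⟩
    card ((S +⟨ v ⟩) ∩⊥ w) + card ((S +⟨ v ⟩) ∩⊥ w)
      ≡⟨ cong₂ _+_ kernel-is-S kernel-is-S ⟩
    card S + card S ∎
    where
    v∈span : v ∈ (S +⟨ v ⟩)
    v∈span = span-inr S v (subst (_∈ S) (sym (⊕-self v)) (proj₁ subS))
    kernel-is-S : card ((S +⟨ v ⟩) ∩⊥ w) ≡ card S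
    kernel-is-S = card-ext ((S +⟨ v ⟩) ∩⊥ w) S λ x → pointwise x (S x) refl (S (x ⊕ v)) refl
      where
      pointwise : ∀ x s → S x ≡ s → ∀ t → S (x ⊕ v) ≡ t → (s ∨ t) ∧ not (B a x w) ≡ s
      pointwise x true  Sx _    _    = cong not (S⟂w x Sx)
      pointwise x false _  true  Sxv = cong not (coset-pairs S⟂w Bvw x Sxv)
      pointwise x false _  false _   = refl

  -- W meets the span of S and v only in 0, provided it meets S only in 0 within
  -- v^⊥ and the coset S + v lies off w^⊥ ⊇ W.
  span-disjoint : ∀ {W S v w} → TotallySingular a W → w ∈ W → S ⟂ w → S ⟂ v → B a v w ≡ true →
    (∀ x → x ∈ (W ∩⊥ v) → x ∈ S → x ≡ 0v) → ∀ x → x ∈ W → x ∈ (S +⟨ v ⟩) → x ≡ 0v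
  span-disjoint {W} {S} {v} {w} tsW w∈W S⟂w S⟂v Bvw disjoint x x∈W x∈span with span-cases S v x∈span
  ... | inj₁ x∈S   = disjoint x (∩ker-intro W (B· v) x∈W (S⟂v x x∈S)) x∈S
  ... | inj₂ x+v∈S =
    ⊥-elim (true≢false (trans (sym (coset-pairs S⟂w Bvw x x+v∈S)) (singular-orthogonal tsW x∈W w∈W)))

  -- One step of the induction.  For 0 ≠ w ∈ W pick a singular partner v; an
  -- opposite W₁' of the half-size W₁ = W ∩ v^⊥ inside A ∩ w^⊥ ∩ v^⊥ extends
  -- to the opposite W₁' + ⟨v⟩ of W inside A.
  opposite-step : ∀ {A W} → IsSubspace A → HasPartners A → TotallySingular a W → W ⊆ A →
    ∀ {w} → w ∈ W → w ≢ 0v →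
    (∀ {A₁ W₁} → IsSubspace A₁ → HasPartners A₁ → TotallySingular a W₁ → W₁ ⊆ A₁ →
       card W₁ < card W → ∃ (OppositeIn A₁ W₁)) →
    ∃ (OppositeIn A W)
  opposite-step {A} {W} subA partners tsW@(subW , singW) W⊆A {w} w∈W w≢0 smaller-opposite
    with singular-partner subA partners (W⊆A w w∈W) w≢0 (singW w w∈W)
  ... | v , v∈A , Qv , Bwv = extend (smaller-opposite A′-subspace A′-partners W₁-singular W₁⊆A′ W₁-smaller)
    where
    A′ = (A ∩⊥ w) ∩⊥ v
    W₁ = W ∩⊥ v

    Bvw : B a v w ≡ true
    Bvw = trans (B-sym v w) Bwv

    A′-subspace : IsSubspace A′
    A′-subspace = ∩ker-subspace (A ∩⊥ w) (B· v) (∩ker-subspace A (B· w) subA (B·-linear w)) (B·-linear v)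

    A′-partners : HasPartners A′
    A′-partners = perp-has-partners subA partners (W⊆A w w∈W) v∈A Bwv

    W₁-singular : TotallySingular a W₁
    W₁-singular = ∩ker-subspace W (B· v) subW (B·-linear v) ,
                  λ x x∈W₁ → singW x (proj₁ (∩ker-elim W (B· v) x∈W₁))

    W₁⊆A′ : W₁ ⊆ A′
    W₁⊆A′ x x∈W₁ with ∩ker-elim W (B· v) x∈W₁
    ... | x∈W , Bxv = ∩ker-intro (A ∩⊥ w) (B· v)
                        (∩ker-intro A (B· w) (W⊆A x x∈W) (singular-orthogonal tsW x∈W w∈W)) Bxv

    W-halves : card W ≡ card W₁ + card W₁
    W-halves = card-halving W (B· v) subW (B·-linear v) w∈W Bwv

    W₁-smaller : card W₁ < card W
    W₁-smaller = subst (card W₁ <_) (sym W-halves) (m<m+n (card W₁) (card-pos W₁ 0v (proj₁ (proj₁ W₁-singular))))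

    extend : ∃ (OppositeIn A′ W₁) → ∃ (OppositeIn A W)
    extend (W₁′ , tsW₁′ , W₁′⊆A′ , |W₁′|≡|W₁| , W₁∩W₁′≡0) =
      W₁′ +⟨ v ⟩ ,
      span-singular tsW₁′ Qv W₁′⟂v ,
      span-⊆ subA (λ x x∈ → proj₁ (∩ker-elim A (B· w) (W₁′⊆A∩⊥w x x∈))) v∈A ,
      trans (span-card (proj₁ tsW₁′) W₁′⟂w Bvw) (trans (cong₂ _+_ |W₁′|≡|W₁| |W₁′|≡|W₁|) (sym W-halves)) ,
      span-disjoint tsW w∈W W₁′⟂w W₁′⟂v Bvw W₁∩W₁′≡0
      where
      W₁′⊆A∩⊥w : W₁′ ⊆ (A ∩⊥ w)
      W₁′⊆A∩⊥w x x∈ = proj₁ (∩ker-elim (A ∩⊥ w) (B· v) (W₁′⊆A′ x x∈))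
      W₁′⟂v : W₁′ ⟂ v
      W₁′⟂v x x∈ = proj₂ (∩ker-elim (A ∩⊥ w) (B· v) (W₁′⊆A′ x x∈))
      W₁′⟂w : W₁′ ⟂ w
      W₁′⟂w x x∈ = proj₂ (∩ker-elim A (B· w) (W₁′⊆A∩⊥w x x∈))

  opposite-exists : ∀ {A W} → IsSubspace A → HasPartners A → TotallySingular a W → W ⊆ A → ∃ (OppositeIn A W)
  opposite-exists {A} {W} = <-rec Claim induct (card W) refl
    where
    Claim : ℕ → Set
    Claim k = ∀ {A W} → card W ≡ k → IsSubspace A → HasPartners A → TotallySingular a W → W ⊆ A →
              ∃ (OppositeIn A W)

    _≟ᵛ_ : (x y : F₂^ n) → Dec (x ≡ y)
    _≟ᵛ_ = ≡-decᵛ _≟ᵇ_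

    induct : ∀ k → (∀ {m} → m < k → Claim m) → Claim k
    induct _ smaller {A} {W} refl subA partners tsW W⊆A with search (λ x → (W x ≟ᵇ true) ×-dec ¬? (x ≟ᵛ 0v))
    ... | inj₁ (w , w∈W , w≢0) =
      opposite-step subA partners tsW W⊆A w∈W w≢0 (λ subA₁ p₁ ts₁ ⊆₁ lt → smaller lt refl subA₁ p₁ ts₁ ⊆₁)
    ... | inj₂ no-nonzero = W , tsW , W⊆A , refl , λ x x∈W _ → only-zero x x∈W
      where
      only-zero : ∀ x → x ∈ W → x ≡ 0v
      only-zero x x∈W with x ≟ᵛ 0v
      ... | yes x≡0 = x≡0
      ... | no  x≢0 = ⊥-elim (no-nonzero x (x∈W , x≢0))

  everything : Subset n
  everything _ = true

  everything-subspace : IsSubspace everything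
  everything-subspace = refl , λ _ _ _ _ → refl

  -- F₂ⁿ has partners exactly because no nonzero singular vector is radical.
  everything-has-partners : (∀ r → Rad a r → r ≢ 0v → Q a r ≡ true) → HasPartners everything
  everything-has-partners anisotropic x _ x≢0 Qx with search (λ y → B a x y ≟ᵇ true)
  ... | inj₁ (y , Bxy) = y , refl , Bxy
  ... | inj₂ none      = ⊥-elim (true≢false (trans (sym (anisotropic x x-radical x≢0)) Qx))
    where
    x-radical : Rad a x
    x-radical y = ¬-not (none y)

open Opposite using (opposite-exists; everything-subspace; everything-has-partners)

-- Proposition 3.2.  In fact W ∩ W' = 0, so the vector u may be any nonzero
-- radical vector r₀: its projection onto R along V is r₀ itself, as r₀ + r₀ = 0 ∈ V.
proposition3p2 : (n : ℕ) (a : Coeffs n)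
    → Σ (F₂^ n) (λ r → Rad a r × r ≢ 0v)
    → (∀ r → Rad a r → r ≢ 0v → Q a r ≡ true)
    → (V : Subset n) → IsComplementToRad a V
    → (W : Subset n) → TotallySingular a W
    → Σ (Subset n) λ W' → TotallySingular a W' × card W' ≡ card W
        × Σ (F₂^ n) (λ u → (∀ x → x ∈ W → x ∈ W' → x ≡ 0v ⊎ x ≡ u)
            × Σ (F₂^ n) (λ r → IsProjR a V u r × r ≢ 0v))
proposition3p2 n a (r₀ , r₀-radical , r₀≢0) anisotropic V ((0∈V , _) , _) W tsW
  with opposite-exists a (everything-subspace a) (everything-has-partners a anisotropic) tsW (λ _ _ → refl)
... | W′ , tsW′ , _ , |W′|≡|W| , W∩W′≡0 =
  W′ , tsW′ , |W′|≡|W| ,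
  r₀ , (λ x x∈W x∈W′ → inj₁ (W∩W′≡0 x x∈W x∈W′)) ,
  r₀ , (r₀-radical , subst (_∈ V) (sym (⊕-self r₀)) 0∈V) , r₀≢0
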